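{- For all $\lambda$-terms $M,N$: $M\le_{p_{\mathrm{ctx}}}N$ iff $M\sqsubseteq_{\mathrm{ctx}}N$. Consequently $M\simeq_{p_{\mathrm{ctx}}}N$ iff $M$ and $N$ are contextually equivalent (i.e.\ $M\sqsubseteq_{\mathrm{ctx}}N$ and $N\sqsubseteq_{\mathrm{ctx}}M$).
   Context: Solvability and contexts are the standard notions of the untyped $\lambda$-calculus. $M\sqsubseteq_{\mathrm{ctx}}N$ means: for every context $\mathtt C[-]$, if $\mathtt C[M]$ is solvable then $\mathtt C[N]$ is solvable. Fix an enumeration $(\mathtt C_n[-])_{n\in\mathbb N}$ of all contexts and let $p_{\mathrm{ctx}}(M,N)=\sum\{2^{ -n}\mid \mathtt C_n[M]\text{ is unsolvable or }\mathtt C_n[N]\text{ is unsolvable}\}$. For a map $p$ of this kind, $M\le_p N$ means $p(M,N)\le p(M,M)$, and $\simeq_p$ is the conjunction of $\le_p$ in both directions. -}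

module Defs where

open import Data.Nat using (ℕ; zero; suc; _<_; _≥_; _∸_; _+_; _^_)
open import Data.Nat.Properties using (m^n≢0)
open import Data.Nat as ℕ using (_<ᵇ_; _≡ᵇ_)
open import Data.Bool using (if_then_else_)
open import Data.Integer using (+_)
open import Data.Rational using (ℚ; _/_) renaming (_+_ to _+ℚ_; _≤_ to _≤ℚ_; 0ℚ to 0ℚ)
open import Data.List using (List; []; _∷_; foldr)
open import Data.List.Relation.Unary.All using (All)
open import Data.List.Relation.Unary.Unique.Propositional using (Unique)
open import Data.Product using (Σ; ∃; _×_; _,_)
open import Data.Sum using (_⊎_)
open import Relation.Nullary using (¬_)
open import Relation.Binary.PropositionalEquality using (_≡_)
open import Relation.Binary.Construct.Closure.Equivalence using (EqClosure)

data Λ : Set where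
  var : ℕ → Λ
  lam : Λ → Λ
  app : Λ → Λ → Λ

shift : ℕ → ℕ → Λ → Λ
shift d c (var x) = if x <ᵇ c then var x else var (x + d)
shift d c (lam M) = lam (shift d (suc c) M)
shift d c (app M N) = app (shift d c M) (shift d c N)

subst : ℕ → Λ → Λ → Λ
subst j N (var x) =
  if x ≡ᵇ j then shift j 0 N
  else (if x <ᵇ j then var x else var (x ∸ 1))
subst j N (lam M) = lam (subst (suc j) N M)
subst j N (app M₁ M₂) = app (subst j N M₁) (subst j N M₂)

data _→β_ : Λ → Λ → Set where
  beta : ∀ {M N} → app (lam M) N →β subst 0 N M
  ξlam : ∀ {M M'} → M →β M' → lam M →β lam M'
  ξappₗ : ∀ {M M' N} → M →β M' → app M N →β app M' N
  ξappᵣ : ∀ {M N N'} → N →β N' → app M N →β app M N'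

_=β_ : Λ → Λ → Set
_=β_ = EqClosure _→β_

FreeBelow : ℕ → Λ → Set
FreeBelow n (var x) = x < n
FreeBelow n (lam M) = FreeBelow (suc n) M
FreeBelow n (app M N) = FreeBelow n M × FreeBelow n N

Closed : Λ → Set
Closed = FreeBelow 0

I : Λ
I = lam (var 0)

lams : ℕ → Λ → Λ
lams zero M = M
lams (suc k) M = lam (lams k M)

apps : Λ → List Λ → Λ
apps M [] = M
apps M (N ∷ Ns) = apps (app M N) Ns

Solvable : Λ → Set
Solvable M = Σ ℕ λ k → Closed (lams k M) × Σ (List Λ) λ Ns → apps (lams k M) Ns =β I

Unsolvable : Λ → Set
Unsolvable M = ¬ Solvable M

-- Contexts (with a single kind of hole, possibly occurring several times
-- or not at all); plugging captures free variables.

data Ctx : Set where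
  hole : Ctx
  var  : ℕ → Ctx
  lam  : Ctx → Ctx
  app  : Ctx → Ctx → Ctx

plug : Ctx → Λ → Λ
plug hole M = M
plug (var x) M = var x
plug (lam C) M = lam (plug C M)
plug (app C D) M = app (plug C M) (plug D M)

_⊑ctx_ : Λ → Λ → Set
M ⊑ctx N = (C : Ctx) → Solvable (plug C M) → Solvable (plug C N)

-- Real numbers of the form Σ_{n ∈ S} 2^{-n}, S ⊆ ℕ, and their order.

weight : ℕ → ℚ
weight n = + 1 / (2 ^ n)
  where instance _ = m^n≢0 2 n

sumW : List ℕ → ℚ
sumW = foldr (λ n q → weight n +ℚ q) 0ℚ

FinSub : (ℕ → Set) → List ℕ → Set
FinSub S F = Unique F × All S F

-- Σ_{n∈S} 2^{-n} ≤ Σ_{n∈T} 2^{-n}, with the sums being suprema of finite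
-- partial sums: every finite partial sum of S is below some finite
-- partial sum of T up to arbitrarily small 2^{-k}.
SumLe : (ℕ → Set) → (ℕ → Set) → Set
SumLe S T = (F : List ℕ) → FinSub S F → (k : ℕ) →
  Σ (List ℕ) λ G → FinSub T G × (sumW F ≤ℚ sumW G +ℚ weight k)

-- p_ctx for an enumeration e of contexts:
-- p_ctx(M,N) = Σ { 2^{-n} | C_n[M] unsolvable or C_n[N] unsolvable }

PctxSet : (ℕ → Ctx) → Λ → Λ → ℕ → Set
PctxSet e M N n = Unsolvable (plug (e n) M) ⊎ Unsolvable (plug (e n) N)

PctxLe : (ℕ → Ctx) → Λ → Λ → Λ → Λ → Set
PctxLe e M N M' N' = SumLe (PctxSet e M N) (PctxSet e M' N')

_≤[_]_ : Λ → (ℕ → Ctx) → Λ → Set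
M ≤[ e ] N = PctxLe e M N M M

_≃[_]_ : Λ → (ℕ → Ctx) → Λ → Set
M ≃[ e ] N = (M ≤[ e ] N) × (N ≤[ e ] M)

Enumeration : (ℕ → Ctx) → Set
Enumeration e = (C : Ctx) → ∃ λ n → e n ≡ C

-- Always PctxSet(M,M) ⊆ PctxSet(M,N), and since every context occurs in the enumeration,
-- M ⊑ctx N holds exactly when the reverse inclusion does too (classically). So it suffices
-- that for index sets T ⊆ S the inequality Σ_S 2^-n ≤ Σ_T 2^-n forces S ⊆ T. If n ∈ S ∖ T,
-- take N = n + 2 and the finite set {n} ∪ {m ∈ T | m ≤ N}: any finite subset of T sums to at
-- most Σ_{m ∈ T, m ≤ N} 2^-m + 2^-N, because its elements above N contribute less than 2^-N,
-- and 2^-N + 2^-N = 2^-(n+1) < 2^-n.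
module Submission where

open import Defs
open import Level using (0ℓ)
open import Axiom.ExcludedMiddle using (ExcludedMiddle)
open import Data.Nat as ℕ using (ℕ; suc; _+_; _^_; _≟_; s≤s)
open import Data.Nat.Properties using (m^n≢0; m≤m+n)
open import Data.Integer as ℤ using (+_)
import Data.Integer.GCD as ℤ
import Data.Integer.Properties as ℤ
open import Data.Integer.Tactic.RingSolver using (solve-∀)
open import Data.Rational using (ℚ; mkℚ; ↥_; ↧_; 0ℚ; _≤_; _<_)
  renaming (_+_ to _+ℚ_)
import Data.Rational.Properties as ℚ
import Data.Rational.Unnormalised.Base as ℚᵘ
import Data.Rational.Unnormalised.Properties as ℚᵘ
open import Data.List using (List; []; _∷_; filter; downFrom)
open import Data.List.Properties using (filter-accept; filter-reject)
open import Data.List.Membership.Propositional using (_∈_; _∉_)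
open import Data.List.Membership.Propositional.Properties using (∈-downFrom⁺)
open import Data.List.Relation.Unary.All as All using (All; []; _∷_)
open import Data.List.Relation.Unary.All.Properties using (all-filter)
open import Data.List.Relation.Unary.Any using (here; there)
open import Data.List.Relation.Unary.AllPairs using (_∷_)
open import Data.List.Relation.Unary.Unique.Propositional using (Unique)
open import Data.List.Relation.Unary.Unique.Propositional.Properties
  using (downFrom⁺; filter⁺; Unique[x∷xs]⇒x∉xs)
open import Data.Product using (_×_; _,_; proj₁)
open import Data.Sum using (inj₁; inj₂; reduce)
open import Algebra.Bundles using (CommutativeMonoid)
open import Algebra.Properties.CommutativeSemigroup
  (CommutativeMonoid.commutativeSemigroup ℚ.+-0-commutativeMonoid) using (x∙yz≈y∙xz)
open import Function.Bundles using (_⇔_; mk⇔)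
open import Data.Product.Function.NonDependent.Propositional using (_×-⇔_)
open import Relation.Nullary using (yes; no; ¬_)
open import Relation.Nullary.Decidable using (decidable-stable)
open import Relation.Unary using (Pred; Decidable; _⊆_; ｛_｝; _∖_)
open import Relation.Unary.Properties using (_∩?_; ∁?)
open import Relation.Binary.PropositionalEquality as ≡
  using (_≡_; _≢_; refl; sym; trans; cong; subst₂; module ≡-Reasoning)
open import Function using (_∘_; case_of_)

unitFraction-halves : ∀ p q {d} → ↥ p ≡ + 1 → ↥ q ≡ + 1 → ↧ p ≡ + 2 ℤ.* d → ↧ q ≡ d → p +ℚ p ≡ q
unitFraction-halves p@(mkℚ _ _ _) q@(mkℚ _ _ _) {d} refl refl ↧p ↧q = ℚ.toℚᵘ-injective
  (ℚᵘ.≃-trans (ℚ.toℚᵘ-homo-+ p p) (ℚᵘ.*≡* (subst₂ cross (sym ↧p) (sym ↧q) (double d))))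
  where
  cross : ℤ.ℤ → ℤ.ℤ → Set
  cross a b = (+ 1 ℤ.* a ℤ.+ + 1 ℤ.* a) ℤ.* b ≡ + 1 ℤ.* (a ℤ.* a)
  double : ∀ d → (+ 1 ℤ.* (+ 2 ℤ.* d) ℤ.+ + 1 ℤ.* (+ 2 ℤ.* d)) ℤ.* d ≡ + 1 ℤ.* ((+ 2 ℤ.* d) ℤ.* (+ 2 ℤ.* d))
  double = solve-∀

↥weight : ∀ n → ↥ weight n ≡ + 1
↥weight n = begin
  ↥ weight n                               ≡⟨ ℤ.*-identityʳ _ ⟨
  ↥ weight n ℤ.* + 1                       ≡⟨ cong (↥ weight n ℤ.*_) (ℤ.gcd-zeroˡ (+ (2 ^ n))) ⟨
  ↥ weight n ℤ.* ℤ.gcd (+ 1) (+ (2 ^ n))  ≡⟨ ℚ.↥-/ (+ 1) (2 ^ n) {{m^n≢0 2 n}} ⟩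
  + 1                                      ∎
  where open ≡-Reasoning

↧weight : ∀ n → ↧ weight n ≡ + (2 ^ n)
↧weight n = begin
  ↧ weight n                               ≡⟨ ℤ.*-identityʳ _ ⟨
  ↧ weight n ℤ.* + 1                       ≡⟨ cong (↧ weight n ℤ.*_) (ℤ.gcd-zeroˡ (+ (2 ^ n))) ⟨
  ↧ weight n ℤ.* ℤ.gcd (+ 1) (+ (2 ^ n))  ≡⟨ ℚ.↧-/ (+ 1) (2 ^ n) {{m^n≢0 2 n}} ⟩
  + (2 ^ n)                                ∎
  where open ≡-Reasoning

weight-suc+weight-suc : ∀ n → weight (suc n) +ℚ weight (suc n) ≡ weight n
weight-suc+weight-suc n = unitFraction-halves (weight (suc n)) (weight n)
  (↥weight (suc n)) (↥weight n) (trans (↧weight (suc n)) (ℤ.pos-* 2 (2 ^ n))) (↧weight n)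

weight-pos : ∀ n → 0ℚ < weight n
weight-pos n = ℚ.positive⁻¹ (weight n) {{ℚ.normalize-pos 1 (2 ^ n) {{m^n≢0 2 n}}}}

weight-nonneg : ∀ n → 0ℚ ≤ weight n
weight-nonneg n = ℚ.<⇒≤ (weight-pos n)

weight-suc<weight : ∀ n → weight (suc n) < weight n
weight-suc<weight n = begin-strict
  weight (suc n)                   ≡⟨ ℚ.+-identityʳ _ ⟨
  weight (suc n) +ℚ 0ℚ             <⟨ ℚ.+-monoʳ-< (weight (suc n)) (weight-pos (suc n)) ⟩
  weight (suc n) +ℚ weight (suc n) ≡⟨ weight-suc+weight-suc n ⟩
  weight n                         ∎
  where open ℚ.≤-Reasoning

p≤q+p : ∀ {p q} → 0ℚ ≤ q → p ≤ q +ℚ p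
p≤q+p {p} {q} 0≤q = ≡.subst (_≤ q +ℚ p) (ℚ.+-identityˡ p) (ℚ.+-monoˡ-≤ p 0≤q)

sumW-nonneg : ∀ xs → 0ℚ ≤ sumW xs
sumW-nonneg []       = ℚ.≤-refl
sumW-nonneg (x ∷ xs) = ℚ.+-mono-≤ (weight-nonneg x) (sumW-nonneg xs)

_∖｛_｝? : {P : Pred ℕ 0ℓ} → Decidable P → (x : ℕ) → Decidable (P ∖ ｛ x ｝)
P? ∖｛ x ｝? = P? ∩? ∁? (x ≟_)

tailBound : {P : Pred ℕ 0ℓ} → Decidable P → ℕ → ℚ
tailBound P? N = sumW (filter P? (downFrom (suc N))) +ℚ weight N

module _ {P : Pred ℕ 0ℓ} (P? : Decidable P) where

  filter-∖-∉ : ∀ {x xs} → x ∉ xs → filter (P? ∖｛ x ｝?) xs ≡ filter P? xs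
  filter-∖-∉ {x} {[]}     x∉ = refl
  filter-∖-∉ {x} {y ∷ ys} x∉ = case P? y of λ where
      (yes py) → begin
        filter (P? ∖｛ x ｝?) (y ∷ ys)  ≡⟨ filter-accept (P? ∖｛ x ｝?) (py , x∉ ∘ here) ⟩
        y ∷ filter (P? ∖｛ x ｝?) ys    ≡⟨ cong (y ∷_) (filter-∖-∉ (x∉ ∘ there)) ⟩
        y ∷ filter P? ys               ≡⟨ filter-accept P? py ⟨
        filter P? (y ∷ ys)             ∎
      (no ¬py) → begin
        filter (P? ∖｛ x ｝?) (y ∷ ys)  ≡⟨ filter-reject (P? ∖｛ x ｝?) (¬py ∘ proj₁) ⟩
        filter (P? ∖｛ x ｝?) ys        ≡⟨ filter-∖-∉ (x∉ ∘ there) ⟩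
        filter P? ys                   ≡⟨ filter-reject P? ¬py ⟨
        filter P? (y ∷ ys)             ∎
    where open ≡-Reasoning

  sumW-filter-∖ : ∀ {x xs} → Unique xs → x ∈ xs → P x →
                  sumW (filter P? xs) ≡ weight x +ℚ sumW (filter (P? ∖｛ x ｝?) xs)
  sumW-filter-∖ {x} {x ∷ xs} u (here refl) px = begin
    sumW (filter P? (x ∷ xs))
      ≡⟨ cong sumW (filter-accept P? px) ⟩
    weight x +ℚ sumW (filter P? xs)
      ≡⟨ cong ((weight x +ℚ_) ∘ sumW) (filter-∖-∉ (Unique[x∷xs]⇒x∉xs u)) ⟨
    weight x +ℚ sumW (filter (P? ∖｛ x ｝?) xs)
      ≡⟨ cong ((weight x +ℚ_) ∘ sumW) (filter-reject (P? ∖｛ x ｝?) x≢x) ⟨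
    weight x +ℚ sumW (filter (P? ∖｛ x ｝?) (x ∷ xs)) ∎
    where
    open ≡-Reasoning
    x≢x : ¬ (P ∖ ｛ x ｝) x
    x≢x (_ , x≢x) = x≢x refl
  sumW-filter-∖ {x} {y ∷ xs} (y∉xs ∷ u) (there x∈xs) px = case P? y of λ where
      (yes py) → begin
        sumW (filter P? (y ∷ xs))
          ≡⟨ cong sumW (filter-accept P? py) ⟩
        weight y +ℚ sumW (filter P? xs)
          ≡⟨ cong (weight y +ℚ_) (sumW-filter-∖ u x∈xs px) ⟩
        weight y +ℚ (weight x +ℚ σ)
          ≡⟨ x∙yz≈y∙xz (weight y) (weight x) σ ⟩
        weight x +ℚ (weight y +ℚ σ)
          ≡⟨ cong ((weight x +ℚ_) ∘ sumW) (filter-accept (P? ∖｛ x ｝?) (py , x≢y)) ⟨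
        weight x +ℚ sumW (filter (P? ∖｛ x ｝?) (y ∷ xs)) ∎
      (no ¬py) → begin
        sumW (filter P? (y ∷ xs))
          ≡⟨ cong sumW (filter-reject P? ¬py) ⟩
        sumW (filter P? xs)
          ≡⟨ sumW-filter-∖ u x∈xs px ⟩
        weight x +ℚ σ
          ≡⟨ cong ((weight x +ℚ_) ∘ sumW) (filter-reject (P? ∖｛ x ｝?) (¬py ∘ proj₁)) ⟨
        weight x +ℚ sumW (filter (P? ∖｛ x ｝?) (y ∷ xs)) ∎
    where
    open ≡-Reasoning
    σ : ℚ
    σ = sumW (filter (P? ∖｛ x ｝?) xs)
    x≢y : x ≢ y
    x≢y = All.lookup y∉xs x∈xs ∘ sym

  sumW-filter-∷ : ∀ x xs → sumW (filter P? (x ∷ xs)) ≤ weight x +ℚ sumW (filter P? xs)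
  sumW-filter-∷ x xs = case P? x of λ where
    (yes px) → ℚ.≤-reflexive (cong sumW (filter-accept P? px))
    (no ¬px) → ℚ.≤-trans (ℚ.≤-reflexive (cong sumW (filter-reject P? ¬px)))
                         (p≤q+p (weight-nonneg x))

  tailBound-suc≤ : ∀ N → tailBound P? (suc N) ≤ tailBound P? N
  tailBound-suc≤ N = begin
    sumW (filter P? (suc N ∷ downFrom (suc N))) +ℚ weight (suc N)
      ≤⟨ ℚ.+-monoˡ-≤ (weight (suc N)) (sumW-filter-∷ (suc N) _) ⟩
    (weight (suc N) +ℚ σ) +ℚ weight (suc N)
      ≡⟨ cong (_+ℚ weight (suc N)) (ℚ.+-comm (weight (suc N)) σ) ⟩
    (σ +ℚ weight (suc N)) +ℚ weight (suc N)
      ≡⟨ ℚ.+-assoc σ (weight (suc N)) (weight (suc N)) ⟩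
    σ +ℚ (weight (suc N) +ℚ weight (suc N))
      ≡⟨ cong (σ +ℚ_) (weight-suc+weight-suc N) ⟩
    σ +ℚ weight N ∎
    where
    open ℚ.≤-Reasoning
    σ : ℚ
    σ = sumW (filter P? (downFrom (suc N)))

  tailBound-antitone : ∀ k N → tailBound P? (k + N) ≤ tailBound P? N
  tailBound-antitone ℕ.zero    N = ℚ.≤-refl
  tailBound-antitone (suc k) N = ℚ.≤-trans (tailBound-suc≤ (k + N)) (tailBound-antitone k N)

sumW≤tailBound : {P : Pred ℕ 0ℓ} (P? : Decidable P) (N : ℕ) {G : List ℕ} →
                 Unique G → All P G → sumW G ≤ tailBound P? N
sumW≤tailBound P? N {[]}    _          _         =
  ℚ.+-mono-≤ (sumW-nonneg (filter P? (downFrom (suc N)))) (weight-nonneg N)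
sumW≤tailBound P? N {x ∷ G} (x∉G ∷ uG) (px ∷ pG) = begin
  weight x +ℚ sumW G
    ≤⟨ ℚ.+-monoʳ-≤ (weight x) (sumW≤tailBound (P? ∖｛ x ｝?) M uG (All.zip (pG , x∉G))) ⟩
  weight x +ℚ (σ +ℚ weight M)
    ≡⟨ ℚ.+-assoc (weight x) σ (weight M) ⟨
  (weight x +ℚ σ) +ℚ weight M
    ≡⟨ cong (_+ℚ weight M) (sumW-filter-∖ P? (downFrom⁺ (suc M)) x∈ds px) ⟨
  tailBound P? M
    ≤⟨ tailBound-antitone P? x N ⟩
  tailBound P? N ∎
  where
  open ℚ.≤-Reasoning
  M : ℕ
  M = x + N
  x∈ds : x ∈ downFrom (suc M)
  x∈ds = ∈-downFrom⁺ (s≤s (m≤m+n x N))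
  σ : ℚ
  σ = sumW (filter (P? ∖｛ x ｝?) (downFrom (suc M)))

⊆⇒SumLe : {S T : Pred ℕ 0ℓ} → S ⊆ T → SumLe S T
⊆⇒SumLe S⊆T F (uF , sF) k =
  F , (uF , All.map S⊆T sF) ,
  ℚ.≤-trans (p≤q+p (weight-nonneg k)) (ℚ.≤-reflexive (ℚ.+-comm (weight k) (sumW F)))

SumLe⇒⊆ : {S T : Pred ℕ 0ℓ} → Decidable T → T ⊆ S → SumLe S T → S ⊆ T
SumLe⇒⊆ {S} {T} T? T⊆S S≤T {n} Sn = decidable-stable (T? n) (λ ¬Tn → ℚ.<-irrefl refl (strict ¬Tn))
  where
  N : ℕ
  N = suc (suc n)
  below : List ℕ
  below = filter T? (downFrom (suc N))
  σ : ℚ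
  σ = sumW below
  n∉below : ¬ T n → All (n ≢_) below
  n∉below ¬Tn = All.map (λ Ty n≡y → ¬Tn (≡.subst T (sym n≡y) Ty)) (all-filter T? _)
  n∷below-FinSub : ¬ T n → FinSub S (n ∷ below)
  n∷below-FinSub ¬Tn =
    (n∉below ¬Tn ∷ filter⁺ T? (downFrom⁺ (suc N))) , (Sn ∷ All.map T⊆S (all-filter T? _))
  strict : ¬ T n → weight n +ℚ σ < weight n +ℚ σ
  strict ¬Tn with S≤T (n ∷ below) (n∷below-FinSub ¬Tn) N
  ... | G , (uG , tG) , ≤G = begin-strict
    weight n +ℚ σ                 ≤⟨ ≤G ⟩
    sumW G +ℚ weight N            ≤⟨ ℚ.+-monoˡ-≤ (weight N) (sumW≤tailBound T? N uG tG) ⟩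
    (σ +ℚ weight N) +ℚ weight N   ≡⟨ ℚ.+-assoc σ (weight N) (weight N) ⟩
    σ +ℚ (weight N +ℚ weight N)   ≡⟨ cong (σ +ℚ_) (weight-suc+weight-suc (suc n)) ⟩
    σ +ℚ weight (suc n)           <⟨ ℚ.+-monoʳ-< σ (weight-suc<weight n) ⟩
    σ +ℚ weight n                 ≡⟨ ℚ.+-comm σ (weight n) ⟩
    weight n +ℚ σ                 ∎
    where open ℚ.≤-Reasoning

module _ (e : ℕ → Ctx) where

  PctxSet-refl⊆ : ∀ M N → PctxSet e M M ⊆ PctxSet e M N
  PctxSet-refl⊆ M N (inj₁ ¬sM) = inj₁ ¬sM
  PctxSet-refl⊆ M N (inj₂ ¬sM) = inj₁ ¬sM

  ⊑ctx⇒PctxSet⊆ : ∀ {M N} → M ⊑ctx N → PctxSet e M N ⊆ PctxSet e M M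
  ⊑ctx⇒PctxSet⊆ M⊑N     (inj₁ ¬sM) = inj₁ ¬sM
  ⊑ctx⇒PctxSet⊆ M⊑N {n} (inj₂ ¬sN) = inj₁ (¬sN ∘ M⊑N (e n))

  PctxSet⊆⇒⊑ctx : ExcludedMiddle 0ℓ → Enumeration e → ∀ {M N} → PctxSet e M N ⊆ PctxSet e M M → M ⊑ctx N
  PctxSet⊆⇒⊑ctx em enum MN⊆MM C sM with enum C
  ... | n , refl = decidable-stable em (λ ¬sN → reduce (MN⊆MM (inj₂ ¬sN)) sM)

  ≤⇔⊑ctx : ExcludedMiddle 0ℓ → Enumeration e → ∀ M N → (M ≤[ e ] N) ⇔ (M ⊑ctx N)
  ≤⇔⊑ctx em enum M N = mk⇔
    (PctxSet⊆⇒⊑ctx em enum ∘ SumLe⇒⊆ (λ _ → em) (PctxSet-refl⊆ M N))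
    (⊆⇒SumLe ∘ ⊑ctx⇒PctxSet⊆)

proposition17 : ExcludedMiddle 0ℓ → (e : ℕ → Ctx) → Enumeration e → (M N : Λ) →
    ((M ≤[ e ] N) ⇔ (M ⊑ctx N)) × ((M ≃[ e ] N) ⇔ ((M ⊑ctx N) × (N ⊑ctx M)))
proposition17 em e enum M N = ≤⇔⊑ M N , (≤⇔⊑ M N ×-⇔ ≤⇔⊑ N M)
  where
  ≤⇔⊑ : ∀ M N → (M ≤[ e ] N) ⇔ (M ⊑ctx N)
  ≤⇔⊑ = ≤⇔⊑ctx e em enum
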